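{- Let $D$ be a dictionary and $p$ a string of length $m$. The procedure $\mathsf{getOutStates}(p)$ described below runs in $O(m\log\sigma + u_o)$ time, where $u_o$ is the number of states of $\mathrm{AC}(D)$ on which the output function should be updated, i.e. the number of states $s$ of $\mathrm{AC}(D)$ such that $p$ is a suffix of $s$. Procedure $\mathsf{getOutStates}(p)$: starting at the source of $\mathrm{DAWG}(D)$, follow the edges labeled $p[1], \dots, p[m]$; if some edge does not exist, return $\emptyset$. Otherwise let $v$ be the node reached; traverse by breadth-first search over inverse suffix links all nodes $u$ with $\mathsf{slink}^i(u) = v$ for some $i \geq 0$, and return the set of $\pi(u)$ over all such $u$ that are trunk nodes.
   Context: Strings are over an alphabet $\Sigma$ of size $\sigma$. A dictionary is a finite set $D = \{p_1, \dots, p_r\}$ of nonempty strings. $\mathrm{Pref}(D)$ is the set of all prefixes (including $\varepsilon$) of strings of $D$, and $\mathrm{Substr}(D)$ the set of all their substrings; the states of the Aho–Corasick automaton $\mathrm{AC}(D)$ are the elements of $\mathrm{Pref}(D)$, and the output function of state $s$ is the set of patterns of $D$ that are suffixes of $s$. For a string $x$ let $\mathrm{endPos}_D(x) = \{(i,j) : x = p_i[j-|x|+1 : j],\ |x| \leq j \leq |p_i|\}$. For $x, y \in \mathrm{Substr}(D)$ write $x \equiv_D y$ iff $\mathrm{endPos}_D(x) = \mathrm{endPos}_D(y)$, with class $[x]_D$. $\mathrm{DAWG}(D)$ has node set $\{[x]_D : x \in \mathrm{Substr}(D)\}$, edges $([x]_D, c, [xc]_D)$ for $x, xc \in \mathrm{Substr}(D)$,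 $c\in\Sigma$, and source $[\varepsilon]_D$; outgoing edges of a node are stored so that the edge with a given label can be found in $O(\log\sigma)$ time. For a non-source node, $\mathsf{slink}([x]_D) = [y]_D$ with $y$ the longest suffix of $x$ such that $y \not\equiv_D x$; $\mathsf{slink}^0$ is the identity. For each node $v$, the set of nodes $u$ with $\mathsf{slink}(u)=v$ (at most $\sigma$ of them, with distinct labels) is stored in an ordered array. A node $v$ is a trunk node if $v=[w]_D$ for some $w\in\mathrm{Pref}(D)$, and $\pi(v)$ denotes the unique element of $\mathrm{Pref}(D)$ in $v$. -}

module Defs where

open import Data.Nat using (ℕ; zero; suc; _+_; _*_; _∸_; _≤ᵇ_; _<ᵇ_)
open import Data.Nat.Logarithm using (⌈log₂_⌉)
open import Data.Fin using (Fin)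
import Data.Fin as Fin
open import Data.Bool using (Bool; true; false; if_then_else_; _∧_; not)
open import Data.List using (List; []; _∷_; _++_; length; map; concatMap; filter;
  inits; tails; take; drop; upTo; zip; deduplicate; [_]; filterᵇ)
open import Data.Bool.ListAction using (any)
open import Data.List.Properties using (≡-dec)
open import Data.List.Relation.Unary.All using (All)
open import Data.List.Relation.Unary.Unique.Propositional using (Unique)
open import Data.Maybe using (Maybe; just; nothing)
open import Data.Product using (_×_; _,_; proj₁; proj₂)
open import Relation.Binary.PropositionalEquality using (_≡_; _≢_)
open import Relation.Nullary.Decidable using (⌊_⌋; ¬?)
import Data.Product.Properties as ×P
import Data.Nat.Properties as ℕP

Str : ℕ → Set
Str σ = List (Fin σ)

-- A dictionary: a finite set {p₁,…,p_r} of nonempty strings,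
-- given as a duplicate-free list (p₁ is the head).
Dict : ℕ → Set
Dict σ = List (Str σ)

IsDictionary : ∀ {σ} → Dict σ → Set
IsDictionary D = All (λ w → w ≢ []) D × Unique D

module _ {σ : ℕ} where

  _=ˢ_ : Str σ → Str σ → Bool
  x =ˢ y = ⌊ ≡-dec Fin._≟_ x y ⌋

  isSuffixOf : Str σ → Str σ → Bool
  isSuffixOf x s = (length x ≤ᵇ length s) ∧ (x =ˢ drop (length s ∸ length x) s)

  memˢ : Str σ → List (Str σ) → Bool
  memˢ x xs = any (λ y → x =ˢ y) xs

  -- Pref(D) and Substr(D) (with repetitions)
  PrefL : Dict σ → List (Str σ)
  PrefL D = [] ∷ concatMap inits D

  SubstrL : Dict σ → List (Str σ)
  SubstrL D = [] ∷ concatMap (λ w → concatMap inits (tails w)) D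

  inSubstr : Dict σ → Str σ → Bool
  inSubstr D x = memˢ x (SubstrL D)

  -- endPos_D(x) = {(i,j) : x = p_i[j-|x|+1 : j], |x| ≤ j ≤ |p_i|},
  -- listed in increasing lexicographic order of (i , j) (indices from 1),
  -- so two endPos sets are equal iff the lists are equal.
  endPos : Dict σ → Str σ → List (ℕ × ℕ)
  endPos D x =
    concatMap (λ ip →
      let i = proj₁ ip ; w = proj₂ ip in
      map (λ j → (i , j))
        (filterᵇ (λ j → (length x ≤ᵇ j) ∧
                       (x =ˢ take (length x) (drop (j ∸ length x) w)))
           (upTo (suc (length w)))))
      (zip (map suc (upTo (length D))) D)

  _=ᴱ_ : List (ℕ × ℕ) → List (ℕ × ℕ) → Bool
  a =ᴱ b = ⌊ ≡-dec (×P.≡-dec ℕP._≟_ ℕP._≟_) a b ⌋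

  equivD : Dict σ → Str σ → Str σ → Bool
  equivD D x y = endPos D x =ᴱ endPos D y

  -- DAWG(D).  A node [x]_D (x ∈ Substr(D)) is represented by the longest
  -- string of its class, rep D x.

  longest : List (Str σ) → Str σ
  longest [] = []
  longest (x ∷ xs) = let y = longest xs in
    if length y <ᵇ length x then x else y

  rep : Dict σ → Str σ → Str σ
  rep D x = longest (filterᵇ (λ y → (equivD D x y)) (SubstrL D))

  Node : ℕ → Set
  Node σ' = Str σ'

  nodes : Dict σ → List (Str σ)
  nodes D = deduplicate (≡-dec Fin._≟_) (map (rep D) (SubstrL D))

  source : Dict σ → Str σ
  source D = rep D []

  edge : Dict σ → Str σ → Fin σ → Maybe (Str σ)
  edge D v c = if inSubstr D (v ++ [ c ]) then just (rep D (v ++ [ c ])) else nothing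

  firstOr : Str σ → List (Str σ) → Str σ
  firstOr d [] = d
  firstOr d (x ∷ _) = x

  -- slink([x]_D) = [y]_D, y the longest suffix of x with y ≢_D x
  -- (tails lists suffixes by decreasing length)
  slink : Dict σ → Str σ → Str σ
  slink D v = rep D (firstOr [] (filterᵇ (λ y → not (equivD D v y)) (tails v)))

  -- nodes u ≠ source with slink(u) = v  (the stored inverse-suffix-link array)
  children : Dict σ → Str σ → List (Str σ)
  children D v = filterᵇ (λ u → (not (u =ˢ source D) ∧ (slink D u =ˢ v))) (nodes D)

  trunk : Dict σ → Str σ → Bool
  trunk D v = any (λ s → equivD D v s) (PrefL D)

  π : Dict σ → Str σ → Str σ
  π D v = firstOr [] (filterᵇ (λ s → (equivD D v s)) (PrefL D))

  -- Cost model (unit-cost RAM):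
  --  * finding the outgoing edge with a given label costs 1 + ⌈log₂ σ⌉
  --    (binary search, O(log σ));
  --  * dequeuing a node in the BFS costs 1, scanning its array of
  --    inverse suffix links costs 1 per entry, reporting π(u) costs 1.

  lookupCost : ℕ
  lookupCost = 1 + ⌈log₂ σ ⌉

  walk : Dict σ → Str σ → Str σ → Maybe (Str σ) × ℕ
  walk D v [] = just v , 0
  walk D v (a ∷ p) with edge D v a
  ... | nothing = nothing , lookupCost
  ... | just w  = proj₁ (walk D w p) , lookupCost + proj₂ (walk D w p)

  -- BFS over inverse suffix links (fuel = #nodes + 1, enough since the
  -- inverse suffix links form a tree); returns output and cost
  bfs : Dict σ → ℕ → List (Str σ) → List (Str σ) → ℕ → List (Str σ) × ℕ
  bfs D zero q out c = out , c
  bfs D (suc f) [] out c = out , c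
  bfs D (suc f) (u ∷ q) out c =
    let ch = children D u in
    if trunk D u
      then bfs D f (q ++ ch) (π D u ∷ out) (c + 1 + length ch + 1)
      else bfs D f (q ++ ch) out (c + 1 + length ch)

  getOutStates : Dict σ → Str σ → List (Str σ) × ℕ
  getOutStates D p with walk D (source D) p
  ... | nothing , c = [] , c
  ... | just v , c  = let r = bfs D (suc (length (nodes D))) [ v ] [] 0 in
                      proj₁ r , c + proj₂ r

  time : Dict σ → Str σ → ℕ
  time D p = proj₂ (getOutStates D p)

  -- u_o: number of states s of AC(D) (elements of Pref(D)) with p a suffix of s
  uₒ : Dict σ → Str σ → ℕ
  uₒ D p = length (filterᵇ (λ s → (isSuffixOf p s))
                    (deduplicate (≡-dec Fin._≟_) (PrefL D)))

module Submission where

-- Following the edges labelled p costs at most |p| lookups and, if it succeeds, ends at the node v of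
-- DAWG(D) containing p; every state of AC(D) having v as a suffix has p as a suffix, so uₒ(v) ≤ uₒ(p).
-- The BFS explores the subtree of v in the tree of inverse suffix links. For a node u, a state having a
-- child of u as a suffix has u as a suffix, and no state has two children of u as suffixes; a trunk node
-- is itself a state, and has no child as a suffix. Hence the uₒ-values of the children of u sum to at most
-- uₒ(u), strictly less when u is trunk, while a non-trunk node has at least two children since its
-- occurrences are preceded by at least two different letters. So the potential 5 uₒ(u) - 3 of u pays for
-- visiting u and for the potentials of its children, and the BFS costs at most 5 uₒ(v).

open import Defs
open import Data.Nat using (ℕ; zero; suc; _+_; _*_; _∸_; _⊓_; _≤_; _<_; z≤n; s≤s; _≤ᵇ_; _<ᵇ_)
open import Data.Nat.Properties
open import Algebra.Properties.CommutativeSemigroup +-commutativeSemigroup using () renaming (interchange to +-interchange)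
open import Data.Fin using (Fin)
import Data.Fin as Fin
import Data.Product.Properties as ×
open import Data.Bool using (Bool; true; false; T; _∧_; not; if_then_else_)
open import Data.Bool.Properties using (T-∧; T?)
open import Data.List using (List; []; _∷_; _++_; concat; length; map; take; drop; inits; tails; [_]; filterᵇ; zip; upTo; concatMap; deduplicate)
open import Data.List.Properties using (++-assoc; length-++; ++-identityʳ; take++drop≡id; take-drop; length-take; ∷-injective; ∷-injectiveˡ; ≡-dec; length-map; length-upTo; map-cong-local; length-++-≤ˡ; take-take; ++-conicalˡ)
open import Data.List.Membership.Propositional using (_∈_; find; lose)
open import Data.List.Membership.Propositional.Properties
open import Data.List.Relation.Unary.Any as Any using (here; there)
open import Data.List.Relation.Unary.Any.Properties using (any⁺; any⁻)
open import Data.List.Relation.Unary.All.Properties using (¬All⇒Any¬; ++⁺)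
open import Data.List.Membership.DecPropositional (×.≡-dec _≟_ _≟_) using (_∈?_)
open import Data.List.Relation.Unary.All as All using (All; []; _∷_)
open import Data.List.Relation.Unary.AllPairs using (_∷_)
open import Data.List.Relation.Unary.Unique.Propositional using (Unique)
import Data.List.Relation.Unary.Unique.Propositional.Properties as Unique
open import Data.List.Relation.Unary.Unique.DecPropositional.Properties using (deduplicate-!)
open import Data.Product using (∃-syntax; _×_; _,_; proj₁; proj₂; map₂)
open import Data.Sum using (_⊎_; inj₁; inj₂; [_,_]′)
open import Data.Unit using (tt)
open import Data.Maybe using (just; nothing)
open import Data.Empty using (⊥-elim)
open import Function using (_∘_; _⇔_; Equivalence; mk⇔)
import Function.Properties.Equivalence as ⇔
open import Relation.Binary.PropositionalEquality hiding ([_])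
open import Relation.Nullary using (¬_; yes; no; Dec)
open import Relation.Nullary.Decidable using (⌊_⌋; toWitness; fromWitness; toWitnessFalse; fromWitnessFalse)

module _ {A : Set} where

  Suffix : List A → List A → Set
  Suffix x s = ∃[ t ] t ++ x ≡ s

  Suffix-refl : ∀ x → Suffix x x
  Suffix-refl x = [] , refl

  []-Suffix : ∀ s → Suffix [] s
  []-Suffix s = s , ++-identityʳ s

  Suffix-trans : ∀ {x y z} → Suffix x y → Suffix y z → Suffix x z
  Suffix-trans {x} (t , refl) (t′ , refl) = t′ ++ t , ++-assoc t′ t x

  Suffix-there : ∀ {x s} a → Suffix x s → Suffix x (a ∷ s)
  Suffix-there a (t , e) = a ∷ t , cong (a ∷_) e

  Suffix-length : ∀ {x s} → Suffix x s → length x ≤ length s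
  Suffix-length {x} (t , refl) = subst (length x ≤_) (sym (length-++ t)) (m≤n+m (length x) (length t))

  Suffix-of-[] : ∀ {x} → Suffix x [] → x ≡ []
  Suffix-of-[] ([] , e) = e

  Suffix-antisym : ∀ {x y} → Suffix x y → length y ≤ length x → x ≡ y
  Suffix-antisym ([] , e) _ = e
  Suffix-antisym {x} (a ∷ t , refl) le = ⊥-elim (<⇒≱ (s≤s (Suffix-length (t , refl))) le)

  Suffix-∷⁻ : ∀ {x a s} → Suffix x (a ∷ s) → x ≡ a ∷ s ⊎ Suffix x s
  Suffix-∷⁻ ([] , e) = inj₁ e
  Suffix-∷⁻ (b ∷ t , refl) = inj₂ (t , refl)

  Suffix-snoc : ∀ {x s} c → Suffix x s → Suffix (x ++ [ c ]) (s ++ [ c ])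
  Suffix-snoc {x} c (t , refl) = t , sym (++-assoc t x [ c ])

  Suffix-comparable : ∀ {x y s} → Suffix x s → Suffix y s → length x ≤ length y → Suffix x y
  Suffix-comparable (t , e) (t′ , e′) = go t t′ (trans e (sym e′))
    where
    go : ∀ {x y} t t′ → t ++ x ≡ t′ ++ y → length x ≤ length y → Suffix x y
    go t [] e _ = t , e
    go {x} [] (b ∷ t′) refl le = ⊥-elim (<⇒≱ (s≤s (Suffix-length (t′ , refl))) le)
    go (a ∷ t) (b ∷ t′) e le = go t t′ (proj₂ (∷-injective e)) le

  Suffix-extend : ∀ {x s} → Suffix x s → length x < length s → ∃[ a ] Suffix (a ∷ x) s
  Suffix-extend ([] , refl) lt = ⊥-elim (<-irrefl refl lt)
  Suffix-extend (b ∷ t , e) _ = go b t e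
    where
    go : ∀ {x s} b t → b ∷ t ++ x ≡ s → ∃[ a ] Suffix (a ∷ x) s
    go b [] e = b , [] , e
    go b (c ∷ t) refl with go c t refl
    ... | a , t′ , e′ = a , b ∷ t′ , cong (b ∷_) e′

  drop-length-++ : ∀ (t x : List A) → drop (length t) (t ++ x) ≡ x
  drop-length-++ [] x = refl
  drop-length-++ (a ∷ t) x = drop-length-++ t x

  Suffix⇒≡drop : ∀ {x s} → Suffix x s → x ≡ drop (length s ∸ length x) s
  Suffix⇒≡drop {x} (t , refl) rewrite length-++ t {x} | m+n∸n≡m (length t) (length x) = sym (drop-length-++ t x)

  ≡drop⇒Suffix : ∀ x s → x ≡ drop (length s ∸ length x) s → Suffix x s
  ≡drop⇒Suffix x s e = take k s , trans (cong (take k s ++_) e) (take++drop≡id k s)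
    where k = length s ∸ length x

  take∈inits : ∀ n (w : List A) → take n w ∈ inits w
  take∈inits zero w = here refl
  take∈inits (suc n) [] = here refl
  take∈inits (suc n) (a ∷ w) = there (∈-map⁺ (a ∷_) (take∈inits n w))

  ∈inits⇒≡take : ∀ {s} (w : List A) → s ∈ inits w → ∃[ n ] n ≤ length w × s ≡ take n w
  ∈inits⇒≡take w (here refl) = 0 , z≤n , refl
  ∈inits⇒≡take (a ∷ w) (there m) with ∈-map⁻ (a ∷_) m
  ... | s , m′ , refl with ∈inits⇒≡take w m′
  ... | n , n≤ , refl = suc n , s≤s n≤ , refl

  drop∈tails : ∀ n (w : List A) → drop n w ∈ tails w
  drop∈tails zero w = here refl
  drop∈tails (suc n) [] = here refl
  drop∈tails (suc n) (a ∷ w) = there (drop∈tails n w)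

  ∈tails⇒Suffix : ∀ {t} (w : List A) → t ∈ tails w → Suffix t w
  ∈tails⇒Suffix w (here refl) = Suffix-refl w
  ∈tails⇒Suffix (a ∷ w) (there m) = Suffix-there a (∈tails⇒Suffix w m)

  take-++ : ∀ (t u : List A) n → take (length t + n) (t ++ u) ≡ t ++ take n u
  take-++ [] u n = refl
  take-++ (a ∷ t) u n = cong (a ∷_) (take-++ t u n)

  take-length-++ : ∀ (s r : List A) → take (length s) (s ++ r) ≡ s
  take-length-++ [] r = refl
  take-length-++ (a ∷ s) r = cong (a ∷_) (take-length-++ s r)

  filterᵇ-cong-local : ∀ {p q : A → Bool} {xs} → All (λ x → T (p x) ⇔ T (q x)) xs → filterᵇ p xs ≡ filterᵇ q xs
  filterᵇ-cong-local {xs = []} [] = refl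
  filterᵇ-cong-local {p} {q} {x ∷ xs} (px⇔qx ∷ rest) with p x | q x | Equivalence.to px⇔qx | Equivalence.from px⇔qx
  ... | true  | true  | _ | _ = cong (x ∷_) (filterᵇ-cong-local rest)
  ... | false | false | _ | _ = filterᵇ-cong-local rest
  ... | true  | false | to | _ = ⊥-elim (to tt)
  ... | false | true  | _ | from = ⊥-elim (from tt)

  two-distinct : ∀ {x y} {xs : List A} → x ∈ xs → y ∈ xs → x ≢ y → 2 ≤ length xs
  two-distinct {xs = _ ∷ []} (here refl) (here refl) x≢y = ⊥-elim (x≢y refl)
  two-distinct {xs = _ ∷ _ ∷ _} _ _ _ = s≤s (s≤s z≤n)

  Unique-filterᵇ : ∀ (p : A → Bool) {xs} → Unique xs → Unique (filterᵇ p xs)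
  Unique-filterᵇ p = Unique.filter⁺ (T? ∘ p)

module _ {A B : Set} where

  ∈-zip⁻ˡ : ∀ {ks : List A} {ds : List B} {k d} → (k , d) ∈ zip ks ds → k ∈ ks
  ∈-zip⁻ˡ {_ ∷ _} {_ ∷ _} (here refl) = here refl
  ∈-zip⁻ˡ {_ ∷ _} {_ ∷ _} (there m) = there (∈-zip⁻ˡ m)

  ∈-zip⁻ʳ : ∀ {ks : List A} {ds : List B} {k d} → (k , d) ∈ zip ks ds → d ∈ ds
  ∈-zip⁻ʳ {_ ∷ _} {_ ∷ _} (here refl) = here refl
  ∈-zip⁻ʳ {_ ∷ _} {_ ∷ _} (there m) = there (∈-zip⁻ʳ m)

  ∈-zip⁺ʳ : ∀ {ks : List A} {ds : List B} {d} → length ds ≤ length ks → d ∈ ds → ∃[ k ] (k , d) ∈ zip ks ds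
  ∈-zip⁺ʳ {k ∷ _} {_ ∷ _} _ (here refl) = k , here refl
  ∈-zip⁺ʳ {_ ∷ _} {_ ∷ _} (s≤s le) (there m) = map₂ there (∈-zip⁺ʳ le m)

  zip-functional : ∀ {ks : List A} {ds : List B} {k d d′} → Unique ks →
                   (k , d) ∈ zip ks ds → (k , d′) ∈ zip ks ds → d ≡ d′
  zip-functional {_ ∷ _} {_ ∷ _} _ (here refl) (here refl) = refl
  zip-functional {_ ∷ _} {_ ∷ _} (k∉ ∷ _) (here refl) (there m) = ⊥-elim (All.lookup k∉ (∈-zip⁻ˡ m) refl)
  zip-functional {_ ∷ _} {_ ∷ _} (k∉ ∷ _) (there m) (here refl) = ⊥-elim (All.lookup k∉ (∈-zip⁻ˡ m) refl)
  zip-functional {_ ∷ _} {_ ∷ _} (_ ∷ u) (there m) (there m′) = zip-functional u m m′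

iverson : Bool → ℕ
iverson true = 1
iverson false = 0

module _ {A : Set} where

  sumBy : (A → ℕ) → List A → ℕ
  sumBy f [] = 0
  sumBy f (x ∷ xs) = f x + sumBy f xs

  length-filterᵇ : ∀ (p : A → Bool) xs → length (filterᵇ p xs) ≡ sumBy (iverson ∘ p) xs
  length-filterᵇ p [] = refl
  length-filterᵇ p (x ∷ xs) with p x
  ... | true = cong suc (length-filterᵇ p xs)
  ... | false = length-filterᵇ p xs

  length-filterᵇ-mono : ∀ {p q : A → Bool} xs → (∀ {x} → x ∈ xs → T (p x) → T (q x)) →
                        length (filterᵇ p xs) ≤ length (filterᵇ q xs)
  length-filterᵇ-mono [] _ = z≤n
  length-filterᵇ-mono {p} {q} (x ∷ xs) p⇒q with p x | q x | p⇒q {x} (here refl)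
  ... | true  | true  | _ = s≤s (length-filterᵇ-mono xs (p⇒q ∘ there))
  ... | true  | false | f = ⊥-elim (f tt)
  ... | false | true  | _ = m≤n⇒m≤1+n (length-filterᵇ-mono xs (p⇒q ∘ there))
  ... | false | false | _ = length-filterᵇ-mono xs (p⇒q ∘ there)

  ∈⇒1≤length : ∀ {x} {xs : List A} → x ∈ xs → 1 ≤ length xs
  ∈⇒1≤length {xs = _ ∷ _} _ = s≤s z≤n

  sumBy-++ : ∀ (f : A → ℕ) xs ys → sumBy f (xs ++ ys) ≡ sumBy f xs + sumBy f ys
  sumBy-++ f [] ys = refl
  sumBy-++ f (x ∷ xs) ys = trans (cong (f x +_) (sumBy-++ f xs ys)) (sym (+-assoc (f x) _ _))

  sumBy-+ : ∀ (f g : A → ℕ) xs → sumBy (λ x → f x + g x) xs ≡ sumBy f xs + sumBy g xs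
  sumBy-+ f g [] = refl
  sumBy-+ f g (x ∷ xs) = trans (cong (f x + g x +_) (sumBy-+ f g xs)) (+-interchange (f x) (g x) _ _)

  sumBy-cong-local : ∀ {f g : A → ℕ} xs → (∀ {x} → x ∈ xs → f x ≡ g x) → sumBy f xs ≡ sumBy g xs
  sumBy-cong-local [] _ = refl
  sumBy-cong-local (x ∷ xs) f≡g = cong₂ _+_ (f≡g (here refl)) (sumBy-cong-local xs (f≡g ∘ there))

  sumBy-mono : ∀ {f g : A → ℕ} xs → (∀ {x} → x ∈ xs → f x ≤ g x) → sumBy f xs ≤ sumBy g xs
  sumBy-mono [] _ = z≤n
  sumBy-mono (x ∷ xs) f≤g = +-mono-≤ (f≤g (here refl)) (sumBy-mono xs (f≤g ∘ there))

  sumBy-mono-< : ∀ {f g : A → ℕ} {y} xs → (∀ {x} → x ∈ xs → f x ≤ g x) → y ∈ xs → f y < g y →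
                 sumBy f xs < sumBy g xs
  sumBy-mono-< (x ∷ xs) f≤g (here refl) f<g = +-mono-<-≤ f<g (sumBy-mono xs (f≤g ∘ there))
  sumBy-mono-< (x ∷ xs) f≤g (there y∈) f<g = +-mono-≤-< (f≤g (here refl)) (sumBy-mono-< xs (f≤g ∘ there) y∈ f<g)

  length≤sumBy : ∀ {f : A → ℕ} {xs} → All (λ x → 1 ≤ f x) xs → length xs ≤ sumBy f xs
  length≤sumBy [] = z≤n
  length≤sumBy (1≤fx ∷ rest) = +-mono-≤ 1≤fx (length≤sumBy rest)

  sumBy-iverson-≤ : ∀ (p : A → Bool) b {xs} → Unique xs →
                    (∀ {x y} → x ∈ xs → y ∈ xs → T (p x) → T (p y) → x ≡ y) →
                    (∀ {x} → x ∈ xs → T (p x) → T b) →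
                    sumBy (iverson ∘ p) xs ≤ iverson b
  sumBy-iverson-≤ p b {[]} _ _ _ = z≤n
  sumBy-iverson-≤ p b {x ∷ xs} (x∉ ∷ u) same ⇒b with p x in px
  ... | false = sumBy-iverson-≤ p b u (λ y∈ z∈ → same (there y∈) (there z∈)) (⇒b ∘ there)
  ... | true with b | ⇒b (here refl) (subst T (sym px) tt)
  ...   | false | ()
  ...   | true | _ = s≤s (sumBy-iverson-≤ p false u (λ y∈ z∈ → same (there y∈) (there z∈))
                        (λ y∈ py → All.lookup x∉ y∈ (same (here refl) (there y∈) (subst T (sym px) tt) py)))


module _ {A B : Set} where

  sumBy-swap : ∀ (f : A → B → ℕ) xs ys →
               sumBy (λ x → sumBy (f x) ys) xs ≡ sumBy (λ y → sumBy (λ x → f x y) xs) ys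
  sumBy-swap f xs [] = sumBy-zero xs
    where
    sumBy-zero : ∀ xs → sumBy (λ _ → 0) xs ≡ 0
    sumBy-zero [] = refl
    sumBy-zero (_ ∷ xs) = sumBy-zero xs
  sumBy-swap f xs (y ∷ ys) =
    trans (sumBy-+ (λ x → f x y) (λ x → sumBy (f x) ys) xs) (cong (sumBy (λ x → f x y) xs +_) (sumBy-swap f xs ys))

T⇒1≤iverson : ∀ {b} → T b → 1 ≤ iverson b
T⇒1≤iverson {true} _ = s≤s z≤n

-- End positions

module _ {σ : ℕ} where

  =ˢ⇒≡ : ∀ {x y : Str σ} → T (x =ˢ y) → x ≡ y
  =ˢ⇒≡ = toWitness

  ≡⇒=ˢ : ∀ {x y : Str σ} → x ≡ y → T (x =ˢ y)
  ≡⇒=ˢ = fromWitness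

  isSuffixOf⇒Suffix : ∀ {x s : Str σ} → T (isSuffixOf x s) → Suffix x s
  isSuffixOf⇒Suffix {x} {s} t = ≡drop⇒Suffix x s (=ˢ⇒≡ (proj₂ (Equivalence.to T-∧ t)))

  Suffix⇒isSuffixOf : ∀ {x s : Str σ} → Suffix x s → T (isSuffixOf x s)
  Suffix⇒isSuffixOf sf = Equivalence.from T-∧ (≤⇒≤ᵇ (Suffix-length sf) , ≡⇒=ˢ (Suffix⇒≡drop sf))

  -- The filter by which endPos selects the end positions j in the pattern w.
  endsAt : Str σ → Str σ → ℕ → Bool
  endsAt x w j = (length x ≤ᵇ j) ∧ (x =ˢ take (length x) (drop (j ∸ length x) w))

  endsAt⇔Suffix : ∀ x (w : Str σ) {j} → j ≤ length w → T (endsAt x w j) ⇔ Suffix x (take j w)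
  endsAt⇔Suffix x w {j} j≤ = mk⇔ to from
    where
    |take| : length (take j w) ≡ j
    |take| = trans (length-take j w) (m≤n⇒m⊓n≡m j≤)
    window : length x ≤ j → take (length x) (drop (j ∸ length x) w) ≡ drop (length (take j w) ∸ length x) (take j w)
    window x≤j = trans (take-drop (length x) (j ∸ length x) w)
                   (cong₂ (λ k l → drop (l ∸ length x) (take k w)) (m∸n+n≡m x≤j) (sym |take|))
    to : T (endsAt x w j) → Suffix x (take j w)
    to t with Equivalence.to T-∧ t
    ... | x≤ᵇj , x≡ = ≡drop⇒Suffix x (take j w) (trans (=ˢ⇒≡ x≡) (window (≤ᵇ⇒≤ (length x) j x≤ᵇj)))
    from : Suffix x (take j w) → T (endsAt x w j)
    from sf = Equivalence.from T-∧ (≤⇒≤ᵇ x≤j , ≡⇒=ˢ (trans (Suffix⇒≡drop sf) (sym (window x≤j))))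
      where x≤j = subst (length x ≤_) |take| (Suffix-length sf)

module _ {σ : ℕ} (D : Dict σ) where

  indexed : List (ℕ × Str σ)
  indexed = zip (map suc (upTo (length D))) D

  indexed-functional : ∀ {i w w′} → (i , w) ∈ indexed → (i , w′) ∈ indexed → w ≡ w′
  indexed-functional = zip-functional (Unique.map⁺ suc-injective (Unique.upTo⁺ (length D)))

  ∈⇒∈indexed : ∀ {w} → w ∈ D → ∃[ i ] (i , w) ∈ indexed
  ∈⇒∈indexed = ∈-zip⁺ʳ (≤-reflexive (sym (trans (length-map suc (upTo (length D))) (length-upTo (length D)))))

  -- Membership of (i , j) in endPos_D(x).
  Occurs : Str σ → ℕ × ℕ → Set
  Occurs x (i , j) = ∃[ w ] (i , w) ∈ indexed × j ≤ length w × Suffix x (take j w)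

  PrefixAt : Str σ → ℕ × ℕ → Set
  PrefixAt s (i , j) = ∃[ w ] (i , w) ∈ indexed × j ≤ length w × s ≡ take j w

  PrefixAt⇒Occurs⇔Suffix : ∀ {s x} p → PrefixAt s p → Occurs x p ⇔ Suffix x s
  PrefixAt⇒Occurs⇔Suffix (i , j) (w , m , j≤ , refl) = mk⇔ to (λ sf → w , m , j≤ , sf)
    where
    to : ∀ {x} → Occurs x (i , j) → Suffix x (take j w)
    to (w′ , m′ , _ , sf) with indexed-functional m m′
    ... | refl = sf

  Occurs⇒PrefixAt : ∀ {x} p → Occurs x p → ∃[ s ] PrefixAt s p × Suffix x s
  Occurs⇒PrefixAt (i , j) (w , m , j≤ , sf) = take j w , (w , m , j≤ , refl) , sf

  Occurs-suffix : ∀ {x y} p → Suffix x y → Occurs y p → Occurs x p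
  Occurs-suffix (i , j) x⊑y (w , m , j≤ , sf) = w , m , j≤ , Suffix-trans x⊑y sf

  Occurs-comparable : ∀ {x y} p → Occurs x p → Occurs y p → length x ≤ length y → Suffix x y
  Occurs-comparable p ox oy with Occurs⇒PrefixAt p ox
  ... | s , at , x⊑s = Suffix-comparable x⊑s (Equivalence.to (PrefixAt⇒Occurs⇔Suffix p at) oy)

  ∈endPos⇒Occurs : ∀ {x i j} → (i , j) ∈ endPos D x → Occurs x (i , j)
  ∈endPos⇒Occurs {x} m with find (∈-concatMap⁻ _ {xs = indexed} m)
  ... | (i , w) , m₁ , m₂ with ∈-map⁻ (i ,_) m₂
  ... | j , m₃ , refl with ∈-filter⁻ (λ j → T? (endsAt x w j)) m₃
  ... | j∈ , t = w , m₁ , j≤ , Equivalence.to (endsAt⇔Suffix x w j≤) t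
    where j≤ = ≤-pred (∈-upTo⁻ j∈)

  Occurs⇒∈endPos : ∀ {x i j} → Occurs x (i , j) → (i , j) ∈ endPos D x
  Occurs⇒∈endPos {x} {i} {j} (w , m , j≤ , sf) =
    ∈-concatMap⁺ _ {xs = indexed} (lose m (∈-map⁺ (i ,_)
      (∈-filter⁺ (λ j → T? (endsAt x w j)) (∈-upTo⁺ (s≤s j≤)) (Equivalence.from (endsAt⇔Suffix x w j≤) sf))))

  endPos-ext : ∀ {x y} → (∀ p → Occurs x p ⇔ Occurs y p) → endPos D x ≡ endPos D y
  endPos-ext {x} {y} occ⇔ =
    cong concat (map-cong-local {xs = indexed} (All.tabulate λ {(i , w)} m → cong (map (i ,_)) (same-ends m)))
    where
    same-ends : ∀ {i w} → (i , w) ∈ indexed →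
                filterᵇ (endsAt x w) (upTo (suc (length w))) ≡ filterᵇ (endsAt y w) (upTo (suc (length w)))
    same-ends {i} {w} m = filterᵇ-cong-local (All.tabulate λ {j} j∈ →
      let j≤ = ≤-pred (∈-upTo⁻ j∈)
          at : ∀ {z} → Occurs z (i , j) ⇔ Suffix z (take j w)
          at = PrefixAt⇒Occurs⇔Suffix (i , j) (w , m , j≤ , refl)
      in ⇔.trans (endsAt⇔Suffix x w j≤) (⇔.trans (⇔.sym at) (⇔.trans (occ⇔ (i , j))
           (⇔.trans at (⇔.sym (endsAt⇔Suffix y w j≤))))))

  endPos-≡⇒Occurs : ∀ {x y} p → endPos D x ≡ endPos D y → Occurs x p → Occurs y p
  endPos-≡⇒Occurs {x} (i , j) e o = ∈endPos⇒Occurs (subst ((i , j) ∈_) e (Occurs⇒∈endPos o))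

  ∈Substr⇒Occurs : ∀ {x} → x ∈ SubstrL D → x ≢ [] → ∃[ p ] Occurs x p
  ∈Substr⇒Occurs (here refl) x≢[] = ⊥-elim (x≢[] refl)
  ∈Substr⇒Occurs (there m) _ with find (∈-concatMap⁻ (λ w → concatMap inits (tails w)) {xs = D} m)
  ... | w , w∈D , m₁ with find (∈-concatMap⁻ inits {xs = tails w} m₁)
  ... | t , t∈ , x∈ with ∈inits⇒≡take t x∈ | ∈tails⇒Suffix w t∈ | ∈⇒∈indexed w∈D
  ... | n , n≤ , refl | u , refl | i , m₂ =
    (i , length u + n) , u ++ t , m₂ , j≤ , u , sym (take-++ u t n)
    where j≤ = subst (length u + n ≤_) (sym (length-++ u)) (+-monoʳ-≤ (length u) n≤)

  Occurs⇒∈Substr : ∀ {x} p → Occurs x p → x ∈ SubstrL D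
  Occurs⇒∈Substr {x} (i , j) (w , m , j≤ , u , e) =
    there (∈-concatMap⁺ (λ w → concatMap inits (tails w)) {xs = D} (lose (∈-zip⁻ʳ m)
      (∈-concatMap⁺ inits {xs = tails w} (lose (drop∈tails (length u) w)
        (subst (_∈ inits (drop (length u) w)) (sym x≡) (take∈inits (length x) (drop (length u) w)))))))
    where
    |u|+|x| : length u + length x ≡ j
    |u|+|x| = trans (sym (length-++ u)) (trans (cong length e) (trans (length-take j w) (m≤n⇒m⊓n≡m j≤)))
    x≡ : x ≡ take (length x) (drop (length u) w)
    x≡ = begin
      x                                                 ≡⟨ drop-length-++ u x ⟨
      drop (length u) (u ++ x)                          ≡⟨ cong (drop (length u)) e ⟩
      drop (length u) (take j w)                        ≡⟨ cong (λ k → drop (length u) (take k w)) |u|+|x| ⟨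
      drop (length u) (take (length u + length x) w)    ≡⟨ take-drop (length x) (length u) w ⟨
      take (length x) (drop (length u) w)               ∎
      where open ≡-Reasoning

  ∈Pref⇒PrefixAt : ∀ {s} → s ∈ PrefL D → s ≡ [] ⊎ ∃[ p ] PrefixAt s p
  ∈Pref⇒PrefixAt (here refl) = inj₁ refl
  ∈Pref⇒PrefixAt (there m) with find (∈-concatMap⁻ inits {xs = D} m)
  ... | w , w∈D , s∈ with ∈inits⇒≡take w s∈ | ∈⇒∈indexed w∈D
  ... | n , n≤ , refl | i , m′ = inj₂ ((i , n) , w , m′ , n≤ , refl)

  PrefixAt⇒∈Pref : ∀ {s} p → PrefixAt s p → s ∈ PrefL D
  PrefixAt⇒∈Pref (i , j) (w , m , _ , refl) = there (∈-concatMap⁺ inits {xs = D} (lose (∈-zip⁻ʳ m) (take∈inits j w)))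

  PrefixAt-++⁻ˡ : ∀ {s r i j} → PrefixAt (s ++ r) (i , j) → PrefixAt s (i , length s)
  PrefixAt-++⁻ˡ {s} {r} {i} {j} (w , m , j≤ , e) = w , m , ≤-trans |s|≤j j≤ , s≡
    where
    |s|≤j : length s ≤ j
    |s|≤j = ≤-trans (length-++-≤ˡ s) (≤-trans (≤-reflexive (trans (cong length e) (length-take j w))) (m⊓n≤m j _))
    s≡ : s ≡ take (length s) w
    s≡ = begin
      s                                ≡⟨ take-length-++ s r ⟨
      take (length s) (s ++ r)         ≡⟨ cong (take (length s)) e ⟩
      take (length s) (take j w)       ≡⟨ take-take (length s) j w ⟩
      take (length s ⊓ j) w            ≡⟨ cong (λ k → take k w) (m≤n⇒m⊓n≡m |s|≤j) ⟩
      take (length s) w                ∎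
      where open ≡-Reasoning

  Pref-++⁻ˡ : ∀ {s r} → (s ++ r) ∈ PrefL D → s ∈ PrefL D
  Pref-++⁻ˡ {s} {r} sr∈ = by-cases (∈Pref⇒PrefixAt {s ++ r} sr∈)
    where
    by-cases : s ++ r ≡ [] ⊎ ∃[ p ] PrefixAt (s ++ r) p → s ∈ PrefL D
    by-cases (inj₁ e) = subst (_∈ PrefL D) (sym (++-conicalˡ s r e)) (here refl)
    by-cases (inj₂ ((i , j) , at)) = PrefixAt⇒∈Pref (i , length s) (PrefixAt-++⁻ˡ {s} {r} at)

  Pref⊆Substr : ∀ {s} → s ∈ PrefL D → s ∈ SubstrL D
  Pref⊆Substr m with ∈Pref⇒PrefixAt m
  ... | inj₁ refl = here refl
  ... | inj₂ (p , at) = Occurs⇒∈Substr p (Equivalence.from (PrefixAt⇒Occurs⇔Suffix p at) (Suffix-refl _))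

  endPos-≡[]⇒≡[] : ∀ {x} → x ∈ SubstrL D → endPos D x ≡ endPos D [] → x ≡ []
  endPos-≡[]⇒≡[] {[]} _ _ = refl
  endPos-≡[]⇒≡[] {a ∷ x} x∈ e with ∈Substr⇒Occurs {a ∷ x} x∈ (λ ())
  ... | (i , _) , w , m , _ with endPos-≡⇒Occurs {[]} {a ∷ x} (i , 0) (sym e) (w , m , z≤n , []-Suffix [])
  ... | _ , _ , _ , ax⊑[] with () ← Suffix-of-[] ax⊑[]

  endPos-sandwich : ∀ {x y z} → Suffix x y → Suffix y z → endPos D x ≡ endPos D z → endPos D y ≡ endPos D z
  endPos-sandwich {x} {y} {z} x⊑y y⊑z e = endPos-ext λ p →
    mk⇔ (λ oy → endPos-≡⇒Occurs {x} {z} p e (Occurs-suffix p x⊑y oy)) (Occurs-suffix p y⊑z)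

  endPos? : ∀ x y → Dec (endPos D x ≡ endPos D y)
  endPos? x y = ≡-dec (×.≡-dec _≟_ _≟_) (endPos D x) (endPos D y)

  equivD⇒≡ : ∀ {x y} → T (equivD D x y) → endPos D x ≡ endPos D y
  equivD⇒≡ {x} {y} = toWitness {a? = endPos? x y}

  ≡⇒equivD : ∀ {x y} → endPos D x ≡ endPos D y → T (equivD D x y)
  ≡⇒equivD {x} {y} = fromWitness {a? = endPos? x y}

  ¬equivD⇒≢ : ∀ {x y} → T (not (equivD D x y)) → endPos D x ≢ endPos D y
  ¬equivD⇒≢ {x} {y} = toWitnessFalse {a? = endPos? x y}

  ≢⇒¬equivD : ∀ {x y} → endPos D x ≢ endPos D y → T (not (equivD D x y))
  ≢⇒¬equivD {x} {y} = fromWitnessFalse {a? = endPos? x y}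

-- Nodes of DAWG(D)

module _ {σ : ℕ} where

  longest-∈ : ∀ {x} (xs : List (Str σ)) → x ∈ xs → longest xs ∈ xs
  longest-∈ (y ∷ ys) _ = go y ys
    where
    go : ∀ y ys → longest (y ∷ ys) ∈ y ∷ ys
    go y ys with length (longest ys) <ᵇ length y in lt
    go y ys       | true = here refl
    go [] []      | false = here refl
    go (_ ∷ _) [] | false with () ← lt
    go y (z ∷ zs) | false = there (go z zs)

  longest-maximal : ∀ {y} (xs : List (Str σ)) → y ∈ xs → length y ≤ length (longest xs)
  longest-maximal (x ∷ xs) m with length (longest xs) <ᵇ length x in lt
  longest-maximal (x ∷ xs) (here refl) | true = ≤-refl
  longest-maximal (x ∷ xs) (there m)   | true = ≤-trans (longest-maximal xs m) (<⇒≤ (<ᵇ⇒< _ _ (subst T (sym lt) tt)))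
  longest-maximal (x ∷ xs) (here refl) | false = ≮⇒≥ (λ x> → subst T lt (<⇒<ᵇ x>))
  longest-maximal (x ∷ xs) (there m)   | false = longest-maximal xs m

module _ {σ : ℕ} (D : Dict σ) where

  private
    classOf : Str σ → List (Str σ)
    classOf x = filterᵇ (equivD D x) (SubstrL D)

    ∈classOf : ∀ {x y} → y ∈ SubstrL D → endPos D x ≡ endPos D y → y ∈ classOf x
    ∈classOf {x} {y} y∈ e = ∈-filter⁺ (T? ∘ equivD D x) y∈ (≡⇒equivD D {x} {y} e)

    rep∈classOf : ∀ {x} → x ∈ SubstrL D → rep D x ∈ classOf x
    rep∈classOf {x} x∈ = longest-∈ (classOf x) (∈classOf {x} {x} x∈ refl)

  rep-∈Substr : ∀ {x} → x ∈ SubstrL D → rep D x ∈ SubstrL D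
  rep-∈Substr {x} x∈ = proj₁ (∈-filter⁻ (T? ∘ equivD D x) (rep∈classOf x∈))

  endPos-rep : ∀ {x} → x ∈ SubstrL D → endPos D x ≡ endPos D (rep D x)
  endPos-rep {x} x∈ = equivD⇒≡ D {x} {rep D x} (proj₂ (∈-filter⁻ (T? ∘ equivD D x) (rep∈classOf x∈)))

  rep-longest : ∀ {x y} → y ∈ SubstrL D → endPos D x ≡ endPos D y → length y ≤ length (rep D x)
  rep-longest {x} {y} y∈ e = longest-maximal (classOf x) (∈classOf {x} {y} y∈ e)

  -- Unfolding equivD, the definition of rep D x mentions x only through endPos D x.
  rep-cong : ∀ {x x′} → endPos D x ≡ endPos D x′ → rep D x ≡ rep D x′
  rep-cong e = cong (λ E → longest (filterᵇ (λ y → ⌊ ≡-dec (×.≡-dec _≟_ _≟_) E (endPos D y) ⌋) (SubstrL D))) e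

  record IsNode (u : Str σ) : Set where
    constructor isNode
    field
      {origin} : Str σ
      origin∈Substr : origin ∈ SubstrL D
      ≡rep-origin : u ≡ rep D origin

  rep-IsNode : ∀ {x} → x ∈ SubstrL D → IsNode (rep D x)
  rep-IsNode x∈ = isNode x∈ refl

  IsNode⇒∈Substr : ∀ {u} → IsNode u → u ∈ SubstrL D
  IsNode⇒∈Substr (isNode {x} x∈ refl) = rep-∈Substr {x} x∈

  IsNode⇒rep≡ : ∀ {u} → IsNode u → rep D u ≡ u
  IsNode⇒rep≡ (isNode {x} x∈ refl) = rep-cong {rep D x} {x} (sym (endPos-rep {x} x∈))

  IsNode-longest : ∀ {u y} → IsNode u → y ∈ SubstrL D → endPos D u ≡ endPos D y → length y ≤ length u
  IsNode-longest {u} {y} node y∈ e = subst (λ v → length y ≤ length v) (IsNode⇒rep≡ node) (rep-longest {u} {y} y∈ e)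

  IsNode-≡ : ∀ {u v} → IsNode u → IsNode v → endPos D u ≡ endPos D v → u ≡ v
  IsNode-≡ {u} {v} nu nv e = trans (sym (IsNode⇒rep≡ nu)) (trans (rep-cong {u} {v} e) (IsNode⇒rep≡ nv))

  source≡[] : source D ≡ []
  source≡[] = endPos-≡[]⇒≡[] D (rep-∈Substr {[]} (here refl)) (sym (endPos-rep {[]} (here refl)))

-- Suffix links and the tree of inverse suffix links

module _ {σ : ℕ} where

  firstOr-tails-longest : ∀ (P : Str σ → Bool) w {z} → Suffix z w → T (P z) →
    let f = firstOr [] (filterᵇ P (tails w)) in
    Suffix f w × T (P f) × (∀ {z} → Suffix z w → T (P z) → length z ≤ length f)
  firstOr-tails-longest P w z⊑w Pz with P w in Pw
  ... | true = Suffix-refl w , subst T (sym Pw) tt , λ z⊑w _ → Suffix-length z⊑w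
  firstOr-tails-longest P [] z⊑w Pz | false with refl ← Suffix-of-[] z⊑w = ⊥-elim (subst T Pw Pz)
  firstOr-tails-longest P (a ∷ w) z⊑w Pz | false with Suffix-∷⁻ z⊑w
  ... | inj₁ refl = ⊥-elim (subst T Pw Pz)
  ... | inj₂ z⊑w′ with firstOr-tails-longest P w z⊑w′ Pz
  ...   | f⊑w , Pf , maximal = Suffix-there a f⊑w , Pf , shorter
    where
    shorter : ∀ {z} → Suffix z (a ∷ w) → T (P z) → length z ≤ length (firstOr [] (filterᵇ P (tails w)))
    shorter z⊑ Pz with Suffix-∷⁻ z⊑
    ... | inj₁ refl = ⊥-elim (subst T Pw Pz)
    ... | inj₂ z⊑w = maximal z⊑w Pz

module _ {σ : ℕ} (D : Dict σ) where

  slinkSuffix : Str σ → Str σ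
  slinkSuffix w = firstOr [] (filterᵇ (λ y → not (equivD D w y)) (tails w))

  module SuffixLink {w} (node : IsNode D w) (w≢[] : w ≢ []) where

    private
      occurrence : ∃[ p ] Occurs D w p
      occurrence = ∈Substr⇒Occurs D {w} (IsNode⇒∈Substr D node) w≢[]

      p₀ : ℕ × ℕ
      p₀ = proj₁ occurrence

      o₀ : Occurs D w p₀
      o₀ = proj₂ occurrence

      spec : Suffix (slinkSuffix w) w × T (not (equivD D w (slinkSuffix w))) ×
             (∀ {z} → Suffix z w → T (not (equivD D w z)) → length z ≤ length (slinkSuffix w))
      spec = firstOr-tails-longest (λ y → not (equivD D w y)) w ([]-Suffix w)
               (≢⇒¬equivD D {w} {[]} (w≢[] ∘ endPos-≡[]⇒≡[] D (IsNode⇒∈Substr D node)))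

    suffix : Suffix (slinkSuffix w) w
    suffix = proj₁ spec

    endPos-≢ : endPos D w ≢ endPos D (slinkSuffix w)
    endPos-≢ = ¬equivD⇒≢ D {w} {slinkSuffix w} (proj₁ (proj₂ spec))

    maximal : ∀ {z} → Suffix z w → endPos D w ≢ endPos D z → length z ≤ length (slinkSuffix w)
    maximal {z} z⊑w w≢z = proj₂ (proj₂ spec) z⊑w (≢⇒¬equivD D {w} {z} w≢z)

    ∈Substr : slinkSuffix w ∈ SubstrL D
    ∈Substr = Occurs⇒∈Substr D p₀ (Occurs-suffix D p₀ suffix o₀)

    endPos-slink : endPos D (slinkSuffix w) ≡ endPos D (slink D w)
    endPos-slink = endPos-rep D {slinkSuffix w} ∈Substr

    slinkSuffix≤slink : length (slinkSuffix w) ≤ length (slink D w)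
    slinkSuffix≤slink = rep-longest D {slinkSuffix w} {slinkSuffix w} ∈Substr refl

    Occurs-slink : ∀ p → Occurs D w p → Occurs D (slink D w) p
    Occurs-slink p o = endPos-≡⇒Occurs D {slinkSuffix w} {slink D w} p endPos-slink (Occurs-suffix D p suffix o)

    slink-shorter : length (slink D w) < length w
    slink-shorter = ≰⇒> λ w≤slink →
      let w⊑slink = Occurs-comparable D {w} {slink D w} p₀ o₀ (Occurs-slink p₀ o₀) w≤slink
      in endPos-≢ (trans (endPos-sandwich D suffix w⊑slink endPos-slink) (sym endPos-slink))

  Child : Str σ → Str σ → Set
  Child u w = IsNode D w × w ≢ [] × slink D w ≡ u

  private
    childTest? : ∀ u w → Dec (T (not (w =ˢ source D) ∧ (slink D w =ˢ u)))
    childTest? u w = T? (not (w =ˢ source D) ∧ (slink D w =ˢ u))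

  ∈children⇒Child : ∀ {u w} → w ∈ children D u → Child u w
  ∈children⇒Child {u} {w} m = node , w≢[] , =ˢ⇒≡ (proj₂ tests)
    where
    filtered : w ∈ nodes D × T (not (w =ˢ source D) ∧ (slink D w =ˢ u))
    filtered = ∈-filter⁻ (childTest? u) {xs = nodes D} m
    tests : T (not (w =ˢ source D)) × T (slink D w =ˢ u)
    tests = Equivalence.to T-∧ (proj₂ filtered)
    w≢[] : w ≢ []
    w≢[] e = toWitnessFalse (proj₁ tests) (trans e (sym (source≡[] D)))
    node : IsNode D w
    node with ∈-map⁻ (rep D) (∈-deduplicate⁻ (≡-dec Fin._≟_) (map (rep D) (SubstrL D)) (proj₁ filtered))
    ... | x , x∈ , w≡ = isNode x∈ w≡

  rep∈children : ∀ {u x} → x ∈ SubstrL D → rep D x ≢ [] → slink D (rep D x) ≡ u → rep D x ∈ children D u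
  rep∈children {u} {x} x∈ rep≢[] slink≡u =
    ∈-filter⁺ (childTest? u)
      (∈-deduplicate⁺ (≡-dec Fin._≟_) (∈-map⁺ (rep D) x∈))
      (Equivalence.from T-∧ (fromWitnessFalse (λ e → rep≢[] (trans e (source≡[] D))) , ≡⇒=ˢ slink≡u))

  children-unique : ∀ u → Unique (children D u)
  children-unique u = Unique-filterᵇ (λ w → not (w =ˢ source D) ∧ (slink D w =ˢ u)) {nodes D} nodes-unique
    where
    nodes-unique : Unique (nodes D)
    nodes-unique = deduplicate-! (≡-dec Fin._≟_) (map (rep D) (SubstrL D))

  Child-Occurs : ∀ {u w} p → Child u w → Occurs D w p → Occurs D u p
  Child-Occurs p (node , w≢[] , refl) = SuffixLink.Occurs-slink node w≢[] p

  Child-Suffix-Pref : ∀ {u w s} → Child u w → s ∈ PrefL D → Suffix w s → Suffix u s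
  Child-Suffix-Pref {u} {w} {s} child s∈ w⊑s = by-cases (∈Pref⇒PrefixAt D {s} s∈)
    where
    by-cases : s ≡ [] ⊎ ∃[ p ] PrefixAt D s p → Suffix u s
    by-cases (inj₁ refl) = ⊥-elim (proj₁ (proj₂ child) (Suffix-of-[] w⊑s))
    by-cases (inj₂ (p , at)) = Equivalence.to (PrefixAt⇒Occurs⇔Suffix D {s} {u} p at)
      (Child-Occurs {u} {w} p child (Equivalence.from (PrefixAt⇒Occurs⇔Suffix D {s} {w} p at) w⊑s))

  private
    Child-Suffix-unique-≤ : ∀ {u w₁ w₂ s} → Child u w₁ → Child u w₂ → Suffix w₁ s → Suffix w₂ s →
                            length w₁ ≤ length w₂ → w₁ ≡ w₂
    Child-Suffix-unique-≤ {u} {w₁} {w₂} (n₁ , w₁≢[] , slink₁≡) (n₂ , w₂≢[] , slink₂≡) w₁⊑s w₂⊑s ≤ =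
      by-cases (endPos? D w₁ w₂)
      where
      by-cases : Dec (endPos D w₁ ≡ endPos D w₂) → w₁ ≡ w₂
      by-cases (yes e) = IsNode-≡ D {w₁} {w₂} n₁ n₂ e
      by-cases (no ≢) = ⊥-elim (<⇒≱ (SuffixLink.slink-shorter n₁ w₁≢[]) (begin
        length w₁                  ≤⟨ SuffixLink.maximal n₂ w₂≢[] (Suffix-comparable w₁⊑s w₂⊑s ≤) (≢ ∘ sym) ⟩
        length (slinkSuffix w₂)    ≤⟨ SuffixLink.slinkSuffix≤slink n₂ w₂≢[] ⟩
        length (slink D w₂)        ≡⟨ cong length (trans slink₂≡ (sym slink₁≡)) ⟩
        length (slink D w₁)        ∎))
        where open ≤-Reasoning

  Child-Suffix-unique : ∀ {u w₁ w₂ s} → Child u w₁ → Child u w₂ → Suffix w₁ s → Suffix w₂ s → w₁ ≡ w₂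
  Child-Suffix-unique {w₁ = w₁} {w₂} c₁ c₂ w₁⊑s w₂⊑s =
    [ Child-Suffix-unique-≤ c₁ c₂ w₁⊑s w₂⊑s , sym ∘ Child-Suffix-unique-≤ c₂ c₁ w₂⊑s w₁⊑s ]′ (≤-total (length w₁) (length w₂))

  ∈Pref⇒trunk : ∀ {u} → u ∈ PrefL D → T (trunk D u)
  ∈Pref⇒trunk {u} u∈ = any⁺ (equivD D u) (lose u∈ (≡⇒equivD D {u} {u} refl))

  endPos-≡⇒Suffix-Pref : ∀ {x y s} → x ∈ SubstrL D → s ∈ PrefL D → endPos D x ≡ endPos D y →
                         Suffix y s → Suffix x s
  endPos-≡⇒Suffix-Pref {x} {y} {s} x∈ s∈ e y⊑s = by-cases (∈Pref⇒PrefixAt D {s} s∈)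
    where
    by-cases : s ≡ [] ⊎ ∃[ p ] PrefixAt D s p → Suffix x s
    by-cases (inj₁ refl) = subst (λ v → Suffix v []) (sym x≡[]) (Suffix-refl [])
      where
      x≡[] : x ≡ []
      x≡[] = endPos-≡[]⇒≡[] D x∈ (trans e (cong (endPos D) (Suffix-of-[] y⊑s)))
    by-cases (inj₂ (p , at)) = Equivalence.to (PrefixAt⇒Occurs⇔Suffix D {s} {x} p at)
      (endPos-≡⇒Occurs D {y} {x} p (sym e) (Equivalence.from (PrefixAt⇒Occurs⇔Suffix D {s} {y} p at) y⊑s))

  -- π(u) = u for a trunk node u.
  trunk⇒∈Pref : ∀ {u} → IsNode D u → T (trunk D u) → u ∈ PrefL D
  trunk⇒∈Pref {u} node t = subst (_∈ PrefL D) (sym u≡s) s∈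
    where
    witness : ∃[ s ] s ∈ PrefL D × T (equivD D u s)
    witness = find (any⁻ (equivD D u) (PrefL D) t)
    s : Str σ
    s = proj₁ witness
    s∈ : s ∈ PrefL D
    s∈ = proj₁ (proj₂ witness)
    e : endPos D u ≡ endPos D s
    e = equivD⇒≡ D {u} {s} (proj₂ (proj₂ witness))
    u≡s : u ≡ s
    u≡s = Suffix-antisym (endPos-≡⇒Suffix-Pref (IsNode⇒∈Substr D node) s∈ e (Suffix-refl s))
                         (IsNode-longest D {u} {s} node (Pref⊆Substr D s∈) e)

  Child-longer : ∀ {u w} → Child u w → length u < length w
  Child-longer (node , w≢[] , refl) = SuffixLink.slink-shorter node w≢[]

  ∷-endPos-≢ : ∀ {u c} p → IsNode D u → Occurs D (c ∷ u) p → endPos D (c ∷ u) ≢ endPos D u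
  ∷-endPos-≢ {u} {c} p node o e =
    <⇒≱ ≤-refl (IsNode-longest D {u} {c ∷ u} node (Occurs⇒∈Substr D p o) (sym e))

  -- W is the node of c u.
  slink-extension : ∀ {u c W} p → IsNode D u → IsNode D W → Occurs D (c ∷ u) p →
                    endPos D (c ∷ u) ≡ endPos D W → length (c ∷ u) ≤ length W → slink D W ≡ u
  slink-extension {u} {c} {W} p u-node W-node o e |cu|≤|W| = trans (cong (rep D) y≡u) (IsNode⇒rep≡ D u-node)
    where
    W≢[] : W ≢ []
    W≢[] refl = <⇒≱ (s≤s z≤n) |cu|≤|W|
    module L = SuffixLink W-node W≢[]
    y : Str σ
    y = slinkSuffix W
    cu⊑W : Suffix (c ∷ u) W
    cu⊑W = Occurs-comparable D {c ∷ u} {W} p o (endPos-≡⇒Occurs D {c ∷ u} {W} p e o) |cu|≤|W|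
    u⊑W : Suffix u W
    u⊑W = Suffix-trans (Suffix-there c (Suffix-refl u)) cu⊑W
    u⊑y : Suffix u y
    u⊑y = Suffix-comparable u⊑W L.suffix (L.maximal u⊑W (λ W≡u → ∷-endPos-≢ p u-node o (trans e W≡u)))
    |y|≤|u| : length y ≤ length u
    |y|≤|u| = ≮⇒≥ λ |u|<|y| → L.endPos-≢
      (sym (endPos-sandwich D {c ∷ u} {y} {W} (Suffix-comparable cu⊑W L.suffix |u|<|y|) L.suffix e))
    y≡u : y ≡ u
    y≡u = sym (Suffix-antisym u⊑y |y|≤|u|)

  rep-∷∈children : ∀ {u c} p → IsNode D u → Occurs D (c ∷ u) p → rep D (c ∷ u) ∈ children D u
  rep-∷∈children {u} {c} p node o =
    rep∈children cu∈ W≢[] (slink-extension p node (rep-IsNode D cu∈) o (endPos-rep D {c ∷ u} cu∈) |cu|≤|W|)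
    where
    cu∈ : (c ∷ u) ∈ SubstrL D
    cu∈ = Occurs⇒∈Substr D p o
    |cu|≤|W| : length (c ∷ u) ≤ length (rep D (c ∷ u))
    |cu|≤|W| = rep-longest D {c ∷ u} {c ∷ u} cu∈ refl
    W≢[] : rep D (c ∷ u) ≢ []
    W≢[] W≡[] = <⇒≱ (s≤s z≤n) (subst (λ v → length (c ∷ u) ≤ length v) W≡[] |cu|≤|W|)

  ¬trunk⇒Occurs-∷ : ∀ {u i j} → ¬ T (trunk D u) → Occurs D u (i , j) → ∃[ a ] Occurs D (a ∷ u) (i , j)
  ¬trunk⇒Occurs-∷ {u} {i} {j} ¬trunk (w , m , j≤ , u⊑) = by-cases (length u <? length (take j w))
    where
    by-cases : Dec (length u < length (take j w)) → ∃[ a ] Occurs D (a ∷ u) (i , j)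
    by-cases (yes <) = proj₁ (Suffix-extend u⊑ <) , w , m , j≤ , proj₂ (Suffix-extend u⊑ <)
    by-cases (no ≮) = ⊥-elim (¬trunk (∈Pref⇒trunk (subst (_∈ PrefL D) (sym (Suffix-antisym u⊑ (≮⇒≥ ≮)))
                                        (PrefixAt⇒∈Pref D (i , j) (w , m , j≤ , refl)))))

  endPos-⊂⇒∃Occurs : ∀ {x y} → endPos D x ≢ endPos D y → (∀ q → Occurs D y q → Occurs D x q) →
                      ∃[ q ] Occurs D x q × ¬ Occurs D y q
  endPos-⊂⇒∃Occurs {x} {y} x≢y y⊆x = by-cases (All.all? (_∈? endPos D y) (endPos D x))
    where
    by-cases : Dec (All (_∈ endPos D y) (endPos D x)) → ∃[ q ] Occurs D x q × ¬ Occurs D y q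
    by-cases (yes x⊆y) = ⊥-elim (x≢y (endPos-ext D λ q →
      mk⇔ (λ o → ∈endPos⇒Occurs D (All.lookup x⊆y (Occurs⇒∈endPos D o))) (y⊆x q)))
    by-cases (no x⊈y) with find (¬All⇒Any¬ (_∈? endPos D y) (endPos D x) x⊈y)
    ... | q , q∈x , q∉y = q , ∈endPos⇒Occurs D q∈x , q∉y ∘ Occurs⇒∈endPos D

  ¬trunk⇒2≤children : ∀ {u} → IsNode D u → ¬ T (trunk D u) → 2 ≤ length (children D u)
  ¬trunk⇒2≤children {u} node ¬trunk =
    two-distinct (rep-∷∈children (i , j) node oa) (rep-∷∈children q node ob) distinct
    where
    u≢[] : u ≢ []
    u≢[] refl = ¬trunk (∈Pref⇒trunk (here refl))
    occurrence : ∃[ p ] Occurs D u p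
    occurrence = ∈Substr⇒Occurs D {u} (IsNode⇒∈Substr D node) u≢[]
    i j : ℕ
    i = proj₁ (proj₁ occurrence)
    j = proj₂ (proj₁ occurrence)
    a : Fin σ
    a = proj₁ (¬trunk⇒Occurs-∷ ¬trunk (proj₂ occurrence))
    oa : Occurs D (a ∷ u) (i , j)
    oa = proj₂ (¬trunk⇒Occurs-∷ ¬trunk (proj₂ occurrence))
    -- an end position of u at which u is not preceded by a
    other : ∃[ q ] Occurs D u q × ¬ Occurs D (a ∷ u) q
    other = endPos-⊂⇒∃Occurs {u} {a ∷ u} (∷-endPos-≢ (i , j) node oa ∘ sym)
                                          (λ q → Occurs-suffix D q (Suffix-there a (Suffix-refl u)))
    q : ℕ × ℕ
    q = proj₁ other
    b : Fin σ
    b = proj₁ (¬trunk⇒Occurs-∷ ¬trunk (proj₁ (proj₂ other)))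
    ob : Occurs D (b ∷ u) q
    ob = proj₂ (¬trunk⇒Occurs-∷ ¬trunk (proj₁ (proj₂ other)))
    distinct : rep D (a ∷ u) ≢ rep D (b ∷ u)
    distinct e = proj₂ (proj₂ other) (subst (λ c → Occurs D (c ∷ u) q) (sym a≡b) ob)
      where
      ob′ : Occurs D (b ∷ u) (i , j)
      ob′ = endPos-≡⇒Occurs D {a ∷ u} {b ∷ u} (i , j)
              (trans (endPos-rep D {a ∷ u} (Occurs⇒∈Substr D (i , j) oa))
                (trans (cong (endPos D) e) (sym (endPos-rep D {b ∷ u} (Occurs⇒∈Substr D q ob))))) oa
      a≡b : a ≡ b
      a≡b = ∷-injectiveˡ (Suffix-antisym (Occurs-comparable D {a ∷ u} {b ∷ u} (i , j) oa ob′ ≤-refl) ≤-refl)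

-- Counting states of AC(D)

module _ {σ : ℕ} (D : Dict σ) where

  -- The states of AC(D), each once: uₒ counts those having the argument as a suffix.
  states : List (Str σ)
  states = deduplicate (≡-dec Fin._≟_) (PrefL D)

  ∈states⇒∈Pref : ∀ {s} → s ∈ states → s ∈ PrefL D
  ∈states⇒∈Pref = ∈-deduplicate⁻ (≡-dec Fin._≟_) (PrefL D)

  ∈Pref⇒∈states : ∀ {s} → s ∈ PrefL D → s ∈ states
  ∈Pref⇒∈states = ∈-deduplicate⁺ (≡-dec Fin._≟_)

  ∈Substr⇒Suffix-Pref : ∀ {x} → x ∈ SubstrL D → ∃[ s ] s ∈ PrefL D × Suffix x s
  ∈Substr⇒Suffix-Pref {[]} _ = [] , here refl , Suffix-refl []
  ∈Substr⇒Suffix-Pref {a ∷ x} x∈ with ∈Substr⇒Occurs D {a ∷ x} x∈ (λ ())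
  ... | (i , j) , w , m , j≤ , sf = take j w , PrefixAt⇒∈Pref D (i , j) (w , m , j≤ , refl) , sf

  1≤uₒ : ∀ {x} → x ∈ SubstrL D → 1 ≤ uₒ D x
  1≤uₒ {x} x∈ with ∈Substr⇒Suffix-Pref x∈
  ... | s , s∈ , x⊑s = ∈⇒1≤length (∈-filter⁺ (T? ∘ isSuffixOf x) {xs = states}
                         (∈Pref⇒∈states s∈) (Suffix⇒isSuffixOf x⊑s))

  Entails : Str σ → Str σ → Set
  Entails v x = ∀ {s} → s ∈ PrefL D → Suffix v s → Suffix x s

  Entails⇒uₒ-≤ : ∀ {v x} → Entails v x → uₒ D v ≤ uₒ D x
  Entails⇒uₒ-≤ entails = length-filterᵇ-mono states λ s∈ t →
    Suffix⇒isSuffixOf (entails (∈states⇒∈Pref s∈) (isSuffixOf⇒Suffix t))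

  private
    childrenSuffixCount : Str σ → Str σ → ℕ
    childrenSuffixCount u s = sumBy (λ w → iverson (isSuffixOf w s)) (children D u)

    children-isSuffixOf-unique : ∀ u {s w₁ w₂} → w₁ ∈ children D u → w₂ ∈ children D u →
                                 T (isSuffixOf w₁ s) → T (isSuffixOf w₂ s) → w₁ ≡ w₂
    children-isSuffixOf-unique u {s} {w₁} {w₂} w₁∈ w₂∈ t₁ t₂ =
      Child-Suffix-unique D (∈children⇒Child D w₁∈) (∈children⇒Child D w₂∈)
        (isSuffixOf⇒Suffix {x = w₁} t₁) (isSuffixOf⇒Suffix {x = w₂} t₂)

    childrenSuffixCount-≤ : ∀ u {s} → s ∈ PrefL D → childrenSuffixCount u s ≤ iverson (isSuffixOf u s)
    childrenSuffixCount-≤ u {s} s∈ =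
      sumBy-iverson-≤ (λ w → isSuffixOf w s) (isSuffixOf u s) (children-unique D u) (children-isSuffixOf-unique u)
      (λ {w} w∈ t → Suffix⇒isSuffixOf (Child-Suffix-Pref D (∈children⇒Child D w∈) s∈ (isSuffixOf⇒Suffix {x = w} t)))

    childrenSuffixCount-self : ∀ u → childrenSuffixCount u u ≤ 0
    childrenSuffixCount-self u =
      sumBy-iverson-≤ (λ w → isSuffixOf w u) false (children-unique D u) (children-isSuffixOf-unique u)
      (λ {w} w∈ t → <⇒≱ (Child-longer D (∈children⇒Child D w∈)) (Suffix-length (isSuffixOf⇒Suffix {x = w} t)))

    sumBy-uₒ-children : ∀ u → sumBy (uₒ D) (children D u) ≡ sumBy (childrenSuffixCount u) states
    sumBy-uₒ-children u =
      trans (sumBy-cong-local (children D u) (λ {w} _ → length-filterᵇ (isSuffixOf w) states))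
            (sumBy-swap (λ w s → iverson (isSuffixOf w s)) (children D u) states)

  -- Each state counted for a child of u is counted for u; the state u itself, when u is trunk, only for u.
  sumBy-uₒ-children-≤ : ∀ u → sumBy (uₒ D) (children D u) ≤ uₒ D u
  sumBy-uₒ-children-≤ u = begin
    sumBy (uₒ D) (children D u)                          ≡⟨ sumBy-uₒ-children u ⟩
    sumBy (childrenSuffixCount u) states                 ≤⟨ sumBy-mono states (childrenSuffixCount-≤ u ∘ ∈states⇒∈Pref) ⟩
    sumBy (λ s → iverson (isSuffixOf u s)) states        ≡⟨ length-filterᵇ (isSuffixOf u) states ⟨
    uₒ D u                                               ∎
    where open ≤-Reasoning

  trunk⇒sumBy-uₒ-children-< : ∀ {u} → IsNode D u → T (trunk D u) → sumBy (uₒ D) (children D u) < uₒ D u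
  trunk⇒sumBy-uₒ-children-< {u} node t = begin-strict
    sumBy (uₒ D) (children D u)                          ≡⟨ sumBy-uₒ-children u ⟩
    sumBy (childrenSuffixCount u) states                 <⟨ sumBy-mono-< states (childrenSuffixCount-≤ u ∘ ∈states⇒∈Pref)
                                                              (∈Pref⇒∈states (trunk⇒∈Pref D node t)) at-u ⟩
    sumBy (λ s → iverson (isSuffixOf u s)) states        ≡⟨ length-filterᵇ (isSuffixOf u) states ⟨
    uₒ D u                                               ∎
    where
    open ≤-Reasoning
    at-u : childrenSuffixCount u u < iverson (isSuffixOf u u)
    at-u = ≤-trans (s≤s (childrenSuffixCount-self u)) (T⇒1≤iverson (Suffix⇒isSuffixOf (Suffix-refl u)))

-- Running time of getOutStates

module CostArithmetic where
  open import Data.Nat.Solver using (module +-*-Solver)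
  open +-*-Solver

  bfs-step : ∀ {res c′ c r k R S U} → res + 3 * (r + k) ≤ c′ + 5 * (R + S) →
             c′ + 3 + 5 * S ≤ c + 5 * U + 3 * k → res + 3 * suc r ≤ c + 5 * (U + R)
  bfs-step {res} {c′} {c} {r} {k} {R} {S} {U} ih local = +-cancelʳ-≤ (3 * k) _ _ (begin
    res + 3 * suc r + 3 * k        ≡⟨ solve 3 (λ res r k → res :+ con 3 :* (con 1 :+ r) :+ con 3 :* k
                                                := res :+ con 3 :* (r :+ k) :+ con 3) refl res r k ⟩
    res + 3 * (r + k) + 3          ≤⟨ +-monoˡ-≤ 3 ih ⟩
    c′ + 5 * (R + S) + 3           ≡⟨ solve 3 (λ c′ R S → c′ :+ con 5 :* (R :+ S) :+ con 3
                                                := c′ :+ con 3 :+ con 5 :* S :+ con 5 :* R) refl c′ R S ⟩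
    c′ + 3 + 5 * S + 5 * R         ≤⟨ +-monoˡ-≤ (5 * R) local ⟩
    c + 5 * U + 3 * k + 5 * R      ≡⟨ solve 4 (λ c U k R → c :+ con 5 :* U :+ con 3 :* k :+ con 5 :* R
                                                := c :+ con 5 :* (U :+ R) :+ con 3 :* k) refl c U k R ⟩
    c + 5 * (U + R) + 3 * k        ∎)
    where open ≤-Reasoning

  bfs-trunk : ∀ c k {S U} → S < U → c + 1 + k + 1 + 3 + 5 * S ≤ c + 5 * U + 3 * k
  bfs-trunk c k {S} {U} S<U = begin
    c + 1 + k + 1 + 3 + 5 * S      ≡⟨ solve 3 (λ c k S → c :+ con 1 :+ k :+ con 1 :+ con 3 :+ con 5 :* S
                                                := c :+ con 5 :* (con 1 :+ S) :+ k) refl c k S ⟩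
    c + 5 * suc S + k              ≤⟨ +-mono-≤ (+-monoʳ-≤ c (*-monoʳ-≤ 5 S<U)) (m≤n*m k 3) ⟩
    c + 5 * U + 3 * k              ∎
    where open ≤-Reasoning

  bfs-branching : ∀ c {k S U} → 2 ≤ k → S ≤ U → c + 1 + k + 3 + 5 * S ≤ c + 5 * U + 3 * k
  bfs-branching c {k} {S} {U} 2≤k S≤U = begin
    c + 1 + k + 3 + 5 * S          ≡⟨ solve 3 (λ c k S → c :+ con 1 :+ k :+ con 3 :+ con 5 :* S
                                                := c :+ con 5 :* S :+ (con 4 :+ k)) refl c k S ⟩
    c + 5 * S + (4 + k)            ≤⟨ +-mono-≤ (+-monoʳ-≤ c (*-monoʳ-≤ 5 S≤U)) (+-monoˡ-≤ k (*-monoʳ-≤ 2 2≤k)) ⟩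
    c + 5 * U + (2 * k + k)        ≡⟨ cong (c + 5 * U +_) (solve 1 (λ k → con 2 :* k :+ k := con 3 :* k) refl k) ⟩
    c + 5 * U + 3 * k              ∎
    where open ≤-Reasoning

  walk-failed : ∀ {c W U} → c ≤ W → c ≤ 5 * (W + U)
  walk-failed {c} {W} {U} c≤W = ≤-trans c≤W (≤-trans (m≤m+n W U) (m≤n*m (W + U) 5))

  walk-then-bfs : ∀ {c W b U U′} → c ≤ W → b ≤ 5 * U → U ≤ U′ → c + b ≤ 5 * (W + U′)
  walk-then-bfs {c} {W} {b} {U} {U′} c≤W b≤5U U≤U′ = begin
    c + b                 ≤⟨ +-mono-≤ (≤-trans c≤W (m≤n*m W 5)) (≤-trans b≤5U (*-monoʳ-≤ 5 U≤U′)) ⟩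
    5 * W + 5 * U′        ≡⟨ *-distribˡ-+ 5 W U′ ⟨
    5 * (W + U′)          ∎
    where open ≤-Reasoning

module _ {σ : ℕ} (D : Dict σ) where

  children-IsNode : ∀ u → All (IsNode D) (children D u)
  children-IsNode u = All.tabulate (proj₁ ∘ ∈children⇒Child D)

  private
    split-queue : ∀ q ch {res c′} → res + 3 * length (q ++ ch) ≤ c′ + 5 * sumBy (uₒ D) (q ++ ch) →
                  res + 3 * (length q + length ch) ≤ c′ + 5 * (sumBy (uₒ D) q + sumBy (uₒ D) ch)
    split-queue q ch {res} {c′} = subst₂ (λ l S → res + 3 * l ≤ c′ + 5 * S) (length-++ q) (sumBy-++ (uₒ D) q ch)

  -- Potential argument: each node u in the queue holds 5 uₒ(u) - 3 credits.
  bfs-cost : ∀ fuel q out c → All (IsNode D) q →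
             proj₂ (bfs D fuel q out c) + 3 * length q ≤ c + 5 * sumBy (uₒ D) q
  bfs-cost zero q out c nodes =
    +-monoʳ-≤ c (*-mono-≤ {3} {5} (s≤s (s≤s (s≤s z≤n)))
                  (length≤sumBy {f = uₒ D} {xs = q} (All.map (1≤uₒ D ∘ IsNode⇒∈Substr D) nodes)))
  bfs-cost (suc fuel) [] out c _ = ≤-refl
  bfs-cost (suc fuel) (u ∷ q) out c (node ∷ nodes) = by-trunk (trunk D u) refl
    where
    ch : List (Str σ)
    ch = children D u
    k S R : ℕ
    k = length ch
    S = sumBy (uₒ D) ch
    R = sumBy (uₒ D) q
    rest : ∀ out′ c′ → proj₂ (bfs D fuel (q ++ ch) out′ c′) + 3 * (length q + k) ≤ c′ + 5 * (R + S)
    rest out′ c′ = split-queue q ch {proj₂ (bfs D fuel (q ++ ch) out′ c′)} {c′}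
                     (bfs-cost fuel (q ++ ch) out′ c′ (++⁺ nodes (children-IsNode u)))
    by-trunk : ∀ b → trunk D u ≡ b →
               proj₂ (if b then bfs D fuel (q ++ ch) (π D u ∷ out) (c + 1 + k + 1)
                           else bfs D fuel (q ++ ch) out (c + 1 + k))
                 + 3 * suc (length q) ≤ c + 5 * (uₒ D u + R)
    by-trunk true t =
      CostArithmetic.bfs-step {c′ = c + 1 + k + 1} {c} {length q} {k} {R} {S} {uₒ D u} (rest (π D u ∷ out) (c + 1 + k + 1))
        (CostArithmetic.bfs-trunk c k (trunk⇒sumBy-uₒ-children-< D node (subst T (sym t) tt)))
    by-trunk false t =
      CostArithmetic.bfs-step {c′ = c + 1 + k} {c} {length q} {k} {R} {S} {uₒ D u} (rest out (c + 1 + k))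
        (CostArithmetic.bfs-branching c (¬trunk⇒2≤children D node (subst T t)) (sumBy-uₒ-children-≤ D u))

  bfs-cost-from : ∀ {v} fuel → IsNode D v → proj₂ (bfs D fuel [ v ] [] 0) ≤ 5 * uₒ D v
  bfs-cost-from {v} fuel node = begin
    proj₂ (bfs D fuel [ v ] [] 0)              ≤⟨ m≤m+n _ 3 ⟩
    proj₂ (bfs D fuel [ v ] [] 0) + 3 * 1      ≤⟨ bfs-cost fuel [ v ] [] 0 (node ∷ []) ⟩
    5 * (uₒ D v + 0)                           ≡⟨ cong (5 *_) (+-identityʳ (uₒ D v)) ⟩
    5 * uₒ D v                                 ∎
    where open ≤-Reasoning

  edge≡just⇒ : ∀ {v a w} → edge D v a ≡ just w → (v ++ [ a ]) ∈ SubstrL D × w ≡ rep D (v ++ [ a ])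
  edge≡just⇒ {v} {a} {w} = by-cases (inSubstr D (v ++ [ a ])) refl
    where
    by-cases : ∀ b → inSubstr D (v ++ [ a ]) ≡ b →
               (if b then just (rep D (v ++ [ a ])) else nothing) ≡ just w →
               (v ++ [ a ]) ∈ SubstrL D × w ≡ rep D (v ++ [ a ])
    by-cases true t refl =
      Any.map =ˢ⇒≡ (any⁻ (λ y → (v ++ [ a ]) =ˢ y) (SubstrL D) (subst T (sym t) tt)) , refl
    by-cases false _ ()

  Entails-edge : ∀ {v x a} → Entails D v x → (v ++ [ a ]) ∈ SubstrL D → Entails D (rep D (v ++ [ a ])) (x ++ [ a ])
  Entails-edge {v} {x} {a} entails va∈ {s} s∈ W⊑s with endPos-≡⇒Suffix-Pref D va∈ s∈ (endPos-rep D {v ++ [ a ]} va∈) W⊑s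
  ... | t , refl = subst (Suffix (x ++ [ a ])) (++-assoc t v [ a ]) (Suffix-snoc a (entails tv∈ (t , refl)))
    where
    tv∈ : (t ++ v) ∈ PrefL D
    tv∈ = Pref-++⁻ˡ D {t ++ v} {[ a ]} (subst (_∈ PrefL D) (sym (++-assoc t v [ a ])) s∈)

  walk-cost : ∀ v p → proj₂ (walk D v p) ≤ length p * lookupCost {σ}
  walk-cost v [] = z≤n
  walk-cost v (a ∷ p) with edge D v a
  ... | nothing = m≤m+n (lookupCost {σ}) _
  ... | just w = +-monoʳ-≤ (lookupCost {σ}) (walk-cost w p)

  walk-reaches : ∀ {v x} p → IsNode D v → Entails D v x →
                 ∀ {v′} → proj₁ (walk D v p) ≡ just v′ → IsNode D v′ × Entails D v′ (x ++ p)
  walk-reaches {v} {x} [] node entails refl = node , subst (Entails D v) (sym (++-identityʳ x)) entails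
  walk-reaches {v} {x} (a ∷ p) node entails {v′} reached with edge D v a in edge≡
  ... | nothing with () ← reached
  ... | just w with edge≡just⇒ edge≡
  ...   | va∈ , refl = map₂ (subst (Entails D v′) (++-assoc x [ a ] p))
                         (walk-reaches p (rep-IsNode D va∈) (Entails-edge entails va∈) reached)

  time-bound : ∀ p → time D p ≤ 5 * (length p * lookupCost {σ} + uₒ D p)
  time-bound p with walk D (source D) p | walk-cost (source D) p
                  | walk-reaches p (rep-IsNode D (here refl)) (λ {s} _ _ → []-Suffix s)
  ... | nothing , c | c≤ | _ = CostArithmetic.walk-failed {c} {length p * lookupCost {σ}} {uₒ D p} c≤
  ... | just v , c | c≤ | reached = CostArithmetic.walk-then-bfs {c} {length p * lookupCost {σ}}
                             {proj₂ (bfs D (suc (length (nodes D))) [ v ] [] 0)} {uₒ D v} {uₒ D p} c≤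
                             (bfs-cost-from (suc (length (nodes D))) (proj₁ (reached refl)))
                             (Entails⇒uₒ-≤ D (proj₂ (reached refl)))

lemma8 : ∃[ c ] (∀ {σ : ℕ} (D : Dict σ) → IsDictionary D → (p : Str σ) →
           time D p ≤ c * (length p * lookupCost {σ} + uₒ D p))
lemma8 = 5 , λ D _ → time-bound D
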